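{- Let $K$ be a field of characteristic $0$. For all $f(z),g(z)\in K[[z]]$, \[ \mathcal{M}^{ -1}\big(f(z)g(z)\big)=\widehat{\mathcal{M}}(f)\big(\mathcal{M}^{ -1}(g)\big). \]
   Context: Modified inverse Mellin transform: for $g\in K[[z]]$ write $g(e^z-1)=\sum_kb_kz^k/k!$ and set $\mathcal{M}^{ -1}(g)=\sum_kb_k(-1/z)^{k+1}\in(1/z)K[[1/z]]$. Let $\Delta_1$ be the operator $h(z)\mapsto h(z+1)-h(z)$ on $(1/z)K[[1/z]]$ (with $1/(z+1)^n$ expanded in powers of $1/z$); since $\Delta_1^n$ maps $(1/z)K[[1/z]]$ into $z^{ -n-1}K[[1/z]]$, every series $\sum_nc_n\Delta_1^n$ defines a $K$-linear operator on $(1/z)K[[1/z]]$. $\widehat{\mathcal{M}}$ is the $K$-algebra homomorphism sending $f=\sum_nc_nz^n\in K[[z]]$ to the operator $\widehat{\mathcal{M}}(f)=\sum_nc_n\Delta_1^n$ (i.e. induced by $z\mapsto\Delta_1=\exp(d/dz)-1$). -}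

module Defs where

open import Level using (Level; _⊔_)
open import Data.Nat as ℕ using (ℕ; zero; suc; _∸_)
open import Relation.Nullary using (¬_)
open import Algebra.Bundles using (CommutativeRing)

-- A field: a commutative ring with 1 ≉ 0 in which every nonzero element
-- has a multiplicative inverse (inverse given as a total function; the
-- value at 0 is unconstrained).
record Field (c ℓ : Level) : Set (Level.suc (c ⊔ ℓ)) where
  field
    commutativeRing : CommutativeRing c ℓ
  open CommutativeRing commutativeRing public
  field
    _⁻¹       : Carrier → Carrier
    1≉0       : ¬ (1# ≈ 0#)
    ⁻¹-inverse : ∀ x → ¬ (x ≈ 0#) → (x * (x ⁻¹)) ≈ 1#

module _ {c ℓ : Level} (K : Field c ℓ) where
  open Field K using (Carrier; _≈_; _+_; _*_; -_; _-_; 0#; 1#; _⁻¹)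

  fromℕ : ℕ → Carrier
  fromℕ zero    = 0#
  fromℕ (suc n) = 1# + fromℕ n

  CharZero : Set ℓ
  CharZero = ∀ n → ¬ (fromℕ (suc n) ≈ 0#)

  Σ≤ : ℕ → (ℕ → Carrier) → Carrier
  Σ≤ zero    f = f zero
  Σ≤ (suc n) f = Σ≤ n f + f (suc n)

  PowerSeries : Set c
  PowerSeries = ℕ → Carrier

  _⊛_ : PowerSeries → PowerSeries → PowerSeries
  (f ⊛ g) n = Σ≤ n (λ i → f i * g (n ∸ i))

  oneS : PowerSeries
  oneS zero    = 1#
  oneS (suc n) = 0#

  powS : PowerSeries → ℕ → PowerSeries
  powS u zero    = oneS
  powS u (suc m) = u ⊛ powS u m

  -- composition g(u(z)) for u with zero constant term:
  -- coefficient of z^n is Σ_{m ≤ n} g_m [z^n] u^m  (u^m has order ≥ m)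
  compose : PowerSeries → PowerSeries → PowerSeries
  compose g u n = Σ≤ n (λ m → g m * powS u m n)

  factorial : ℕ → Carrier
  factorial n = fromℕ (n ℕ.!)

  expMinusOne : PowerSeries
  expMinusOne zero    = 0#
  expMinusOne (suc n) = factorial (suc n) ⁻¹

  signPow : ℕ → Carrier
  signPow zero    = 1#
  signPow (suc n) = - signPow n

  -- elements of (1/z)K[[1/z]] : h n is the coefficient of z^{-(n+1)}
  InvSeries : Set c
  InvSeries = ℕ → Carrier

  -- modified inverse Mellin transform:
  -- g(e^z - 1) = Σ_k b_k z^k / k!,  M⁻¹(g) = Σ_k b_k (-1/z)^{k+1}
  bCoeff : PowerSeries → ℕ → Carrier
  bCoeff g k = factorial k * compose g expMinusOne k

  Minv : PowerSeries → InvSeries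
  Minv g k = signPow (suc k) * bCoeff g k

  -- view h ∈ (1/z)K[[1/z]] as a power series H(w) in w = 1/z, H(0) = 0
  toW : InvSeries → PowerSeries
  toW h zero    = 0#
  toW h (suc n) = h n

  -- 1/(z+1) = w/(1+w) = Σ_{j ≥ 1} (-1)^{j-1} w^j   (w = 1/z)
  shiftSeries : PowerSeries
  shiftSeries zero    = 0#
  shiftSeries (suc j) = signPow j

  -- Δ₁ h = h(z+1) - h(z), with h(z+1) = H(w/(1+w)) expanded in w = 1/z
  Δ₁ : InvSeries → InvSeries
  Δ₁ h n = compose (toW h) shiftSeries (suc n) - h n

  Δ₁^ : ℕ → InvSeries → InvSeries
  Δ₁^ zero    h = h
  Δ₁^ (suc m) h = Δ₁ (Δ₁^ m h)

  -- \hat{M}(f) = Σ_n c_n Δ₁^n ; on the coefficient of z^{-(m+1)} only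
  -- n ≤ m contribute since Δ₁^n h ∈ z^{-n-1} K[[1/z]]
  Mhat : PowerSeries → InvSeries → InvSeries
  Mhat f h m = Σ≤ m (λ n → f n * Δ₁^ n h m)

-- The k-th coefficient of M⁻¹(g) is (-1)^{k+1} Σ_{m ≤ k} g_m S(m,k), where
-- S(m,k) = k! [z^k] (e^z - 1)^m counts the surjections from a k-set onto an
-- m-set. Writing (e^z - 1)^{m+1} = e^z (e^z - 1)^m - (e^z - 1)^m gives the
-- recurrence S(m+1,k) = Σ_j C(k,j) S(m,j) - S(m,k). On the other side
-- 1/(z+1)^{j+1} = Σ_k (-1)^{k-j} C(k,j) z^{-(k+1)}, so Δ₁ acts on coefficients
-- by the same signed binomial transform; hence M⁻¹(z g) = Δ₁ M⁻¹(g). Iterating,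
-- M⁻¹(z^n g) = Δ₁ⁿ M⁻¹(g), and the theorem follows by linearity, because the
-- k-th coefficient of M⁻¹(f g) only involves f_0, …, f_k.
module Submission where

open import Level using (Level)
open import Data.Nat as ℕ using (ℕ; zero; suc; _∸_; _≤_; _<_; z≤n; s≤s; _!)
import Data.Nat.Properties as ℕₚ
open import Data.Nat.Properties using (_!≢0; _!*_!≢0)
open import Data.Nat.Combinatorics
  using (_C_; nCk≡n!/k![n-k]!; k![n∸k]!∣n!; nCk≡nC[n∸k]; k>n⇒nCk≡0; nCk+nC[k+1]≡[n+1]C[k+1])
open import Data.Nat.DivMod using (m/n*n≡m)
open import Data.Sum using (inj₁; inj₂)
open import Relation.Nullary using (¬_; yes; no)
open import Relation.Binary.PropositionalEquality as ≡ using (_≡_)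
import Relation.Binary.Reasoning.Setoid as SetoidReasoning
import Algebra.Properties.CommutativeSemigroup as CommutativeSemigroupProperties
open import Defs

module _ {c ℓ : Level} (K : Field c ℓ) where
  open Field K
  open import Algebra.Properties.Ring ring using (-0#≈0#; -‿distribˡ-*; -‿+-comm; x[y-z]≈xy-xz; [y-z]x≈yx-zx)
  open import Algebra.Properties.Semiring.Mult semiring using (_×_; ×1-homo-*)
  open import Algebra.Properties.Monoid.Mult +-monoid using (×-homo-+)
  open CommutativeSemigroupProperties *-commutativeSemigroup using (x∙yz≈y∙xz) renaming (interchange to *-interchange)
  open CommutativeSemigroupProperties +-commutativeSemigroup using () renaming (interchange to +-interchange)
  open SetoidReasoning setoid

  private
    Σ : ℕ → (ℕ → Carrier) → Carrier
    Σ = Σ≤ K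

    sign : ℕ → Carrier
    sign = signPow K

    _⊛ₖ_ : PowerSeries K → PowerSeries K → PowerSeries K
    _⊛ₖ_ = _⊛_ K

  Σ≤-cong : ∀ n {f g : ℕ → Carrier} → (∀ i → i ≤ n → f i ≈ g i) → Σ n f ≈ Σ n g
  Σ≤-cong zero    f≈g = f≈g 0 z≤n
  Σ≤-cong (suc n) f≈g = +-cong (Σ≤-cong n (λ i i≤n → f≈g i (ℕₚ.m≤n⇒m≤1+n i≤n))) (f≈g (suc n) ℕₚ.≤-refl)

  Σ≤-+ : ∀ n (f g : ℕ → Carrier) → Σ n (λ i → f i + g i) ≈ Σ n f + Σ n g
  Σ≤-+ zero    f g = refl
  Σ≤-+ (suc n) f g = trans (+-congʳ (Σ≤-+ n f g)) (+-interchange _ _ _ _)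

  Σ≤-*ˡ : ∀ n x (f : ℕ → Carrier) → x * Σ n f ≈ Σ n (λ i → x * f i)
  Σ≤-*ˡ zero    x f = refl
  Σ≤-*ˡ (suc n) x f = trans (distribˡ x _ _) (+-congʳ (Σ≤-*ˡ n x f))

  Σ≤-*ʳ : ∀ n x (f : ℕ → Carrier) → Σ n f * x ≈ Σ n (λ i → f i * x)
  Σ≤-*ʳ zero    x f = refl
  Σ≤-*ʳ (suc n) x f = trans (distribʳ x _ _) (+-congʳ (Σ≤-*ʳ n x f))

  Σ≤-neg : ∀ n (f : ℕ → Carrier) → - Σ n f ≈ Σ n (λ i → - f i)
  Σ≤-neg zero    f = refl
  Σ≤-neg (suc n) f = trans (sym (-‿+-comm _ _)) (+-congʳ (Σ≤-neg n f))

  Σ≤-- : ∀ n (f g : ℕ → Carrier) → Σ n (λ i → f i - g i) ≈ Σ n f - Σ n g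
  Σ≤-- n f g = trans (Σ≤-+ n f (λ i → - g i)) (+-congˡ (sym (Σ≤-neg n g)))

  Σ≤-zero : ∀ n (f : ℕ → Carrier) → (∀ i → i ≤ n → f i ≈ 0#) → Σ n f ≈ 0#
  Σ≤-zero n f f≈0 = trans (Σ≤-cong n f≈0) (zeros n)
    where
    zeros : ∀ n → Σ n (λ _ → 0#) ≈ 0#
    zeros zero    = refl
    zeros (suc n) = trans (+-congʳ (zeros n)) (+-identityʳ 0#)

  Σ≤-extend : ∀ {n m} (f : ℕ → Carrier) → n ≤ m → (∀ i → n < i → f i ≈ 0#) → Σ m f ≈ Σ n f
  Σ≤-extend {n} {m} f n≤m f≈0 with ℕₚ.m≤n⇒m<n∨m≡n n≤m
  ... | inj₂ ≡.refl = refl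
  Σ≤-extend {n} {suc m} f _ f≈0 | inj₁ (s≤s n≤m) =
    trans (+-cong (Σ≤-extend f n≤m f≈0) (f≈0 (suc m) (s≤s n≤m))) (+-identityʳ _)

  Σ≤-swap : ∀ n m (F : ℕ → ℕ → Carrier) → Σ n (λ i → Σ m (F i)) ≈ Σ m (λ j → Σ n (λ i → F i j))
  Σ≤-swap zero    m F = refl
  Σ≤-swap (suc n) m F = trans (+-congʳ (Σ≤-swap n m F)) (sym (Σ≤-+ m _ _))

  Σ≤-head : ∀ n (f : ℕ → Carrier) → Σ (suc n) f ≈ f 0 + Σ n (λ i → f (suc i))
  Σ≤-head zero    f = refl
  Σ≤-head (suc n) f = trans (+-congʳ (Σ≤-head n f)) (+-assoc _ _ _)

  Σ≤-reverse : ∀ n (f : ℕ → Carrier) → Σ n f ≈ Σ n (λ i → f (n ∸ i))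
  Σ≤-reverse zero    f = refl
  Σ≤-reverse (suc n) f = begin
    Σ n f + f (suc n)                  ≈⟨ +-congʳ (Σ≤-reverse n f) ⟩
    Σ n (λ i → f (n ∸ i)) + f (suc n)  ≈⟨ +-comm _ _ ⟩
    f (suc n) + Σ n (λ i → f (n ∸ i))  ≈⟨ Σ≤-head n (λ i → f (suc n ∸ i)) ⟨
    Σ (suc n) (λ i → f (suc n ∸ i))    ∎

  Σ≤-oneS : ∀ n (X : ℕ → Carrier) → Σ n (λ i → oneS K i * X i) ≈ X 0
  Σ≤-oneS zero    X = *-identityˡ _
  Σ≤-oneS (suc n) X = begin
    Σ (suc n) (λ i → oneS K i * X i)               ≈⟨ Σ≤-head n _ ⟩
    1# * X 0 + Σ n (λ i → 0# * X (suc i))          ≈⟨ +-cong (*-identityˡ _) (Σ≤-zero n _ (λ i _ → zeroˡ _)) ⟩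
    X 0 + 0#                                       ≈⟨ +-identityʳ _ ⟩
    X 0                                            ∎

  signPow-+ : ∀ a b → sign (a ℕ.+ b) ≈ sign a * sign b
  signPow-+ zero    b = sym (*-identityˡ _)
  signPow-+ (suc a) b = trans (-‿cong (signPow-+ a b)) (-‿distribˡ-* _ _)

  fromℕ≡×1# : ∀ n → fromℕ K n ≡ n × 1#
  fromℕ≡×1# zero    = ≡.refl
  fromℕ≡×1# (suc n) = ≡.cong (1# +_) (fromℕ≡×1# n)

  fromℕ-+ : ∀ m n → fromℕ K (m ℕ.+ n) ≈ fromℕ K m + fromℕ K n
  fromℕ-+ m n rewrite fromℕ≡×1# (m ℕ.+ n) | fromℕ≡×1# m | fromℕ≡×1# n = ×-homo-+ 1# m n

  fromℕ-* : ∀ m n → fromℕ K (m ℕ.* n) ≈ fromℕ K m * fromℕ K n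
  fromℕ-* m n rewrite fromℕ≡×1# (m ℕ.* n) | fromℕ≡×1# m | fromℕ≡×1# n = ×1-homo-* m n

  fromℕ-binomial : ∀ {k i} → i ≤ k → fromℕ K (k C i) * (factorial K i * factorial K (k ∸ i)) ≈ factorial K k
  fromℕ-binomial {k} {i} i≤k = begin
    fromℕ K (k C i) * (fromℕ K (i !) * fromℕ K ((k ∸ i) !)) ≈⟨ *-congˡ (fromℕ-* (i !) ((k ∸ i) !)) ⟨
    fromℕ K (k C i) * fromℕ K (i ! ℕ.* (k ∸ i) !)           ≈⟨ fromℕ-* (k C i) _ ⟨
    fromℕ K ((k C i) ℕ.* (i ! ℕ.* (k ∸ i) !))               ≈⟨ reflexive (≡.cong (fromℕ K) binomial) ⟩
    fromℕ K (k !)                                           ∎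
    where
    binomial : (k C i) ℕ.* (i ! ℕ.* (k ∸ i) !) ≡ k !
    binomial = ≡.trans (≡.cong (ℕ._* (i ! ℕ.* (k ∸ i) !)) (nCk≡n!/k![n-k]! i≤k))
                 (m/n*n≡m {{i !* (k ∸ i) !≢0}} (k![n∸k]!∣n! i≤k))

  powS-order : ∀ (u : PowerSeries K) → u 0 ≈ 0# → ∀ m k → k < m → powS K u m k ≈ 0#
  powS-order u u₀≈0 (suc m) k (s≤s k≤m) = Σ≤-zero k _ term
    where
    term : ∀ i → i ≤ k → u i * powS K u m (k ∸ i) ≈ 0#
    term zero    _    = trans (*-congʳ u₀≈0) (zeroˡ _)
    term (suc i) i<k = trans (*-congˡ (powS-order u u₀≈0 m (k ∸ suc i) lower)) (zeroʳ _)
      where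
      lower : k ∸ suc i < m
      lower = ℕₚ.<-≤-trans (ℕₚ.∸-monoʳ-< (s≤s z≤n) i<k) k≤m

  factorial-⊛ : ∀ (a b : PowerSeries K) k →
    factorial K k * (a ⊛ₖ b) k
      ≈ Σ k (λ i → fromℕ K (k C i) * ((factorial K i * a i) * (factorial K (k ∸ i) * b (k ∸ i))))
  factorial-⊛ a b k = trans (Σ≤-*ˡ k _ _) (Σ≤-cong k term)
    where
    term : ∀ i → i ≤ k → factorial K k * (a i * b (k ∸ i))
      ≈ fromℕ K (k C i) * ((factorial K i * a i) * (factorial K (k ∸ i) * b (k ∸ i)))
    term i i≤k = trans (*-congʳ (sym (fromℕ-binomial i≤k)))
      (trans (*-assoc _ _ _) (*-congˡ (*-interchange _ _ _ _)))

  surjections : ℕ → ℕ → Carrier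
  surjections m k = factorial K k * powS K (expMinusOne K) m k

  surjections-vanish : ∀ {m k} → k < m → surjections m k ≈ 0#
  surjections-vanish {m} {k} k<m = trans (*-congˡ (powS-order (expMinusOne K) refl m k k<m)) (zeroʳ _)

  ⊛-shiftSeries-suc : ∀ (X : PowerSeries K) n → (shiftSeries K ⊛ₖ X) (suc n) ≈ Σ n (λ i → sign i * X (n ∸ i))
  ⊛-shiftSeries-suc X n = trans (Σ≤-head n _) (trans (+-congʳ (zeroˡ _)) (+-identityˡ _))

  -- (1 + w) · w/(1 + w) = w, read off coefficientwise.
  ⊛-shiftSeries-recurrence : ∀ (X : PowerSeries K) n →
    (shiftSeries K ⊛ₖ X) (suc n) + (shiftSeries K ⊛ₖ X) n ≈ X n
  ⊛-shiftSeries-recurrence X zero =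
    trans (+-cong (⊛-shiftSeries-suc X 0) (zeroˡ _)) (trans (+-identityʳ _) (*-identityˡ _))
  ⊛-shiftSeries-recurrence X (suc n) = begin
    (shiftSeries K ⊛ₖ X) (suc (suc n)) + (shiftSeries K ⊛ₖ X) (suc n)
      ≈⟨ +-cong (⊛-shiftSeries-suc X (suc n)) (⊛-shiftSeries-suc X n) ⟩
    Σ (suc n) (λ i → sign i * X (suc n ∸ i)) + alternating
      ≈⟨ +-congʳ (Σ≤-head n _) ⟩
    (1# * X (suc n) + Σ n (λ i → (- sign i) * X (n ∸ i))) + alternating
      ≈⟨ +-congʳ (+-cong (*-identityˡ _) (trans (Σ≤-cong n (λ i _ → sym (-‿distribˡ-* _ _))) (sym (Σ≤-neg n _)))) ⟩
    (X (suc n) - alternating) + alternating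
      ≈⟨ +-assoc _ _ _ ⟩
    X (suc n) + (- alternating + alternating)
      ≈⟨ +-congˡ (-‿inverseˡ _) ⟩
    X (suc n) + 0#
      ≈⟨ +-identityʳ _ ⟩
    X (suc n) ∎
    where
    alternating : Carrier
    alternating = Σ n (λ i → sign i * X (n ∸ i))

  signed-pascal : ∀ k j →
    sign (k ∸ j) * fromℕ K (k C j) - sign (k ∸ suc j) * fromℕ K (k C suc j)
      ≈ sign (k ∸ j) * fromℕ K (suc k C suc j)
  signed-pascal k j = begin
    sign (k ∸ j) * fromℕ K (k C j) - sign (k ∸ suc j) * fromℕ K (k C suc j)
      ≈⟨ +-congˡ sign-flip ⟩
    sign (k ∸ j) * fromℕ K (k C j) + sign (k ∸ j) * fromℕ K (k C suc j)
      ≈⟨ distribˡ _ _ _ ⟨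
    sign (k ∸ j) * (fromℕ K (k C j) + fromℕ K (k C suc j))
      ≈⟨ *-congˡ (fromℕ-+ (k C j) (k C suc j)) ⟨
    sign (k ∸ j) * fromℕ K (k C j ℕ.+ k C suc j)
      ≈⟨ *-congˡ (reflexive (≡.cong (fromℕ K) (nCk+nC[k+1]≡[n+1]C[k+1] k j))) ⟩
    sign (k ∸ j) * fromℕ K (suc k C suc j) ∎
    where
    sign-flip : - (sign (k ∸ suc j) * fromℕ K (k C suc j)) ≈ sign (k ∸ j) * fromℕ K (k C suc j)
    sign-flip with suc j ℕ.≤? k
    ... | yes j<k = trans (-‿distribˡ-* _ _) (*-congʳ (reflexive (≡.cong sign (≡.sym (ℕₚ.+-∸-assoc 1 j<k)))))
    ... | no  j≮k = trans (-‿cong (vanish (k ∸ suc j))) (trans -0#≈0# (sym (vanish (k ∸ j))))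
      where
      vanish : ∀ i → sign i * fromℕ K (k C suc j) ≈ 0#
      vanish i = trans (*-congˡ (reflexive (≡.cong (fromℕ K) (k>n⇒nCk≡0 (ℕₚ.≰⇒> j≮k))))) (zeroʳ _)

  private
    A : ℕ → PowerSeries K
    A = powS K (shiftSeries K)

    A-vanish : ∀ j k → k < j → A j k ≈ 0#
    A-vanish = powS-order (shiftSeries K) refl

  powS-shiftSeries-recurrence : ∀ j k → A (suc j) (suc k) ≈ A j k - A (suc j) k
  powS-shiftSeries-recurrence j k = begin
    A (suc j) (suc k)                               ≈⟨ +-identityʳ _ ⟨
    A (suc j) (suc k) + 0#                          ≈⟨ +-congˡ (-‿inverseʳ _) ⟨
    A (suc j) (suc k) + (A (suc j) k - A (suc j) k) ≈⟨ +-assoc _ _ _ ⟨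
    (A (suc j) (suc k) + A (suc j) k) - A (suc j) k ≈⟨ +-congʳ (⊛-shiftSeries-recurrence (A j) k) ⟩
    A j k - A (suc j) k                             ∎

  -- [w^{k+1}] (w/(1+w))^{j+1} = (-1)^{k-j} C(k,j); for j > k the binomial vanishes,
  -- so the truncated subtraction in the sign is harmless.
  powS-shiftSeries : ∀ j k → powS K (shiftSeries K) (suc j) (suc k) ≈ sign (k ∸ j) * fromℕ K (k C j)
  powS-shiftSeries zero zero = begin
    A 1 1          ≈⟨ powS-shiftSeries-recurrence 0 0 ⟩
    A 0 0 - A 1 0  ≈⟨ +-congˡ (-‿cong (A-vanish 1 0 (s≤s z≤n))) ⟩
    1# - 0#        ≈⟨ +-congˡ -0#≈0# ⟩
    1# + 0#        ≈⟨ *-identityˡ _ ⟨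
    1# * (1# + 0#) ∎
  powS-shiftSeries (suc j) zero = begin
    A (suc (suc j)) 1               ≈⟨ powS-shiftSeries-recurrence (suc j) 0 ⟩
    A (suc j) 0 - A (suc (suc j)) 0 ≈⟨ +-cong (A-vanish (suc j) 0 (s≤s z≤n)) (-‿cong (A-vanish (suc (suc j)) 0 (s≤s z≤n))) ⟩
    0# - 0#                         ≈⟨ -‿inverseʳ 0# ⟩
    0#                              ≈⟨ zeroʳ 1# ⟨
    1# * 0#                         ∎
  powS-shiftSeries zero (suc k) = begin
    A 1 (suc (suc k))             ≈⟨ powS-shiftSeries-recurrence 0 (suc k) ⟩
    A 0 (suc k) - A 1 (suc k)     ≈⟨ +-identityˡ _ ⟩
    - A 1 (suc k)                 ≈⟨ -‿cong (powS-shiftSeries 0 k) ⟩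
    - (sign k * (1# + 0#))        ≈⟨ -‿distribˡ-* _ _ ⟩
    - sign k * (1# + 0#)          ∎
  powS-shiftSeries (suc j) (suc k) = begin
    A (suc (suc j)) (suc (suc k))
      ≈⟨ powS-shiftSeries-recurrence (suc j) (suc k) ⟩
    A (suc j) (suc k) - A (suc (suc j)) (suc k)
      ≈⟨ +-cong (powS-shiftSeries j k) (-‿cong (powS-shiftSeries (suc j) k)) ⟩
    sign (k ∸ j) * fromℕ K (k C j) - sign (k ∸ suc j) * fromℕ K (k C suc j)
      ≈⟨ signed-pascal k j ⟩
    sign (k ∸ j) * fromℕ K (suc k C suc j) ∎

  Δ₁-coefficients : ∀ h k → Δ₁ K h k ≈ Σ k (λ j → sign (k ∸ j) * fromℕ K (k C j) * h j) - h k
  Δ₁-coefficients h k = +-congʳ (begin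
    compose K (toW K h) (shiftSeries K) (suc k)
      ≈⟨ Σ≤-head k _ ⟩
    0# * A 0 (suc k) + Σ k (λ j → h j * A (suc j) (suc k))
      ≈⟨ trans (+-congʳ (zeroˡ _)) (+-identityˡ _) ⟩
    Σ k (λ j → h j * A (suc j) (suc k))
      ≈⟨ Σ≤-cong k (λ j _ → trans (*-congˡ (powS-shiftSeries j k)) (*-comm _ _)) ⟩
    Σ k (λ j → sign (k ∸ j) * fromℕ K (k C j) * h j) ∎)

  Δ₁-cong : ∀ {h h′ : InvSeries K} → (∀ j → h j ≈ h′ j) → ∀ k → Δ₁ K h k ≈ Δ₁ K h′ k
  Δ₁-cong {h} {h′} h≈h′ k = begin
    Δ₁ K h k
      ≈⟨ Δ₁-coefficients h k ⟩
    Σ k (λ j → sign (k ∸ j) * fromℕ K (k C j) * h j) - h k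
      ≈⟨ +-cong (Σ≤-cong k (λ j _ → *-congˡ (h≈h′ j))) (-‿cong (h≈h′ k)) ⟩
    Σ k (λ j → sign (k ∸ j) * fromℕ K (k C j) * h′ j) - h′ k
      ≈⟨ Δ₁-coefficients h′ k ⟨
    Δ₁ K h′ k ∎

  Minv-surjections : ∀ (h : PowerSeries K) {n} k → k ≤ n →
    Minv K h k ≈ sign (suc k) * Σ n (λ m → h m * surjections m k)
  Minv-surjections h {n} k k≤n = *-congˡ (begin
    factorial K k * Σ k (λ m → h m * powS K (expMinusOne K) m k)
      ≈⟨ Σ≤-*ˡ k _ _ ⟩
    Σ k (λ m → factorial K k * (h m * powS K (expMinusOne K) m k))
      ≈⟨ Σ≤-cong k (λ m _ → x∙yz≈y∙xz _ _ _) ⟩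
    Σ k (λ m → h m * surjections m k)
      ≈⟨ Σ≤-extend _ k≤n (λ m k<m → trans (*-congˡ (surjections-vanish k<m)) (zeroʳ _)) ⟨
    Σ n (λ m → h m * surjections m k) ∎)

  Minv-cong-≤ : ∀ {h h′ : PowerSeries K} k → (∀ m → m ≤ k → h m ≈ h′ m) → Minv K h k ≈ Minv K h′ k
  Minv-cong-≤ {h} {h′} k h≈h′ = begin
    Minv K h k                                        ≈⟨ Minv-surjections h k ℕₚ.≤-refl ⟩
    sign (suc k) * Σ k (λ m → h m * surjections m k)  ≈⟨ *-congˡ (Σ≤-cong k (λ m m≤k → *-congʳ (h≈h′ m m≤k))) ⟩
    sign (suc k) * Σ k (λ m → h′ m * surjections m k) ≈⟨ Minv-surjections h′ k ℕₚ.≤-refl ⟨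
    Minv K h′ k                                       ∎

  Minv-Σ : ∀ (c : ℕ → Carrier) (h : ℕ → PowerSeries K) n k →
    Minv K (λ m → Σ n (λ i → c i * h i m)) k ≈ Σ n (λ i → c i * Minv K (h i) k)
  Minv-Σ c h n k = begin
    Minv K (λ m → Σ n (λ i → c i * h i m)) k
      ≈⟨ Minv-surjections _ k ℕₚ.≤-refl ⟩
    s * Σ k (λ m → Σ n (λ i → c i * h i m) * surjections m k)
      ≈⟨ *-congˡ (Σ≤-cong k (λ m _ → trans (Σ≤-*ʳ n _ _) (Σ≤-cong n (λ i _ → *-assoc _ _ _)))) ⟩
    s * Σ k (λ m → Σ n (λ i → c i * (h i m * surjections m k)))
      ≈⟨ *-congˡ (Σ≤-swap k n _) ⟩
    s * Σ n (λ i → Σ k (λ m → c i * (h i m * surjections m k)))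
      ≈⟨ *-congˡ (Σ≤-cong n (λ i _ → Σ≤-*ˡ k _ _)) ⟨
    s * Σ n (λ i → c i * Σ k (λ m → h i m * surjections m k))
      ≈⟨ Σ≤-*ˡ n _ _ ⟩
    Σ n (λ i → s * (c i * Σ k (λ m → h i m * surjections m k)))
      ≈⟨ Σ≤-cong n (λ i _ → trans (x∙yz≈y∙xz _ _ _) (*-congˡ (sym (Minv-surjections (h i) k ℕₚ.≤-refl)))) ⟩
    Σ n (λ i → c i * Minv K (h i) k) ∎
    where
    s : Carrier
    s = sign (suc k)

  mulZ : PowerSeries K → PowerSeries K
  mulZ h zero    = 0#
  mulZ h (suc m) = h m

  mulZ^ : ℕ → PowerSeries K → PowerSeries K
  mulZ^ zero    h = h
  mulZ^ (suc n) h = mulZ (mulZ^ n h)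

  mulZ^-≥ : ∀ {n m} (h : PowerSeries K) → n ≤ m → mulZ^ n h m ≡ h (m ∸ n)
  mulZ^-≥ h z≤n       = ≡.refl
  mulZ^-≥ h (s≤s n≤m) = mulZ^-≥ h n≤m

  mulZ^-< : ∀ {n m} (h : PowerSeries K) → m < n → mulZ^ n h m ≡ 0#
  mulZ^-< {suc n} {zero}  h _         = ≡.refl
  mulZ^-< {suc n} {suc m} h (s≤s m<n) = mulZ^-< h m<n

  ⊛-mulZ^ : ∀ (f g : PowerSeries K) {n m} → m ≤ n → (f ⊛ₖ g) m ≈ Σ n (λ i → f i * mulZ^ i g m)
  ⊛-mulZ^ f g {n} {m} m≤n = begin
    Σ m (λ i → f i * g (m ∸ i))      ≈⟨ Σ≤-cong m (λ i i≤m → *-congˡ (reflexive (≡.sym (mulZ^-≥ g i≤m)))) ⟩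
    Σ m (λ i → f i * mulZ^ i g m)    ≈⟨ Σ≤-extend _ m≤n (λ i m<i → trans (*-congˡ (reflexive (mulZ^-< g m<i))) (zeroʳ _)) ⟨
    Σ n (λ i → f i * mulZ^ i g m)    ∎

  module _ (char0 : CharZero K) where

    fromℕ-nonZero : ∀ n → .{{ℕ.NonZero n}} → ¬ (fromℕ K n ≈ 0#)
    fromℕ-nonZero (suc n) = char0 n

    factorial-expMinusOne : ∀ i → factorial K i * expMinusOne K i ≈ 1# - oneS K i
    factorial-expMinusOne zero    = trans (zeroʳ _) (sym (-‿inverseʳ 1#))
    factorial-expMinusOne (suc i) = begin
      factorial K (suc i) * factorial K (suc i) ⁻¹ ≈⟨ ⁻¹-inverse _ (fromℕ-nonZero (suc i !) {{suc i !≢0}}) ⟩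
      1#                                           ≈⟨ +-identityʳ 1# ⟨
      1# + 0#                                      ≈⟨ +-congˡ -0#≈0# ⟨
      1# - 0#                                      ∎

    surjections-suc : ∀ m k →
      surjections (suc m) k ≈ Σ k (λ j → fromℕ K (k C j) * surjections m j) - surjections m k
    surjections-suc m k = begin
      factorial K k * (E ⊛ₖ powS K E m) k
        ≈⟨ factorial-⊛ E (powS K E m) k ⟩
      Σ k (λ i → binom i * ((factorial K i * E i) * S (k ∸ i)))
        ≈⟨ Σ≤-cong k (λ i _ → term i) ⟩
      Σ k (λ i → binom i * S (k ∸ i) - oneS K i * (binom i * S (k ∸ i)))
        ≈⟨ Σ≤-- k _ _ ⟩
      Σ k (λ i → binom i * S (k ∸ i)) - Σ k (λ i → oneS K i * (binom i * S (k ∸ i)))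
        ≈⟨ +-cong (Σ≤-reverse k _) (-‿cong (Σ≤-oneS k _)) ⟩
      Σ k (λ j → binom (k ∸ j) * S (k ∸ (k ∸ j))) - (1# + 0#) * S k
        ≈⟨ +-cong (Σ≤-cong k binomial-symmetry) (-‿cong (trans (*-congʳ (+-identityʳ 1#)) (*-identityˡ _))) ⟩
      Σ k (λ j → binom j * S j) - S k ∎
      where
      E : PowerSeries K
      E = expMinusOne K
      S : ℕ → Carrier
      S = surjections m
      binom : ℕ → Carrier
      binom i = fromℕ K (k C i)
      term : ∀ i → binom i * ((factorial K i * E i) * S (k ∸ i))
                     ≈ binom i * S (k ∸ i) - oneS K i * (binom i * S (k ∸ i))
      term i = begin
        binom i * ((factorial K i * E i) * S (k ∸ i))          ≈⟨ *-congˡ (*-congʳ (factorial-expMinusOne i)) ⟩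
        binom i * ((1# - oneS K i) * S (k ∸ i))                ≈⟨ *-congˡ ([y-z]x≈yx-zx _ _ _) ⟩
        binom i * (1# * S (k ∸ i) - oneS K i * S (k ∸ i))      ≈⟨ *-congˡ (+-congʳ (*-identityˡ _)) ⟩
        binom i * (S (k ∸ i) - oneS K i * S (k ∸ i))           ≈⟨ x[y-z]≈xy-xz _ _ _ ⟩
        binom i * S (k ∸ i) - binom i * (oneS K i * S (k ∸ i)) ≈⟨ +-congˡ (-‿cong (x∙yz≈y∙xz _ _ _)) ⟩
        binom i * S (k ∸ i) - oneS K i * (binom i * S (k ∸ i)) ∎
      binomial-symmetry : ∀ j → j ≤ k → binom (k ∸ j) * S (k ∸ (k ∸ j)) ≈ binom j * S j
      binomial-symmetry j j≤k =
        reflexive (≡.cong₂ (λ a b → fromℕ K a * S b) (≡.sym (nCk≡nC[n∸k] j≤k)) (ℕₚ.m∸[m∸n]≡n j≤k))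

    Σ≤-surjections-suc : ∀ (g : PowerSeries K) k →
      Σ k (λ j → fromℕ K (k C j) * Σ k (λ m → g m * surjections m j)) - Σ k (λ m → g m * surjections m k)
        ≈ Σ k (λ m → g m * surjections (suc m) k)
    Σ≤-surjections-suc g k = begin
      Σ k (λ j → binom j * Σ k (λ m → g m * S m j)) - Σ k (λ m → g m * S m k)
        ≈⟨ +-congʳ (Σ≤-cong k (λ j _ → trans (Σ≤-*ˡ k _ _) (Σ≤-cong k (λ m _ → x∙yz≈y∙xz _ _ _)))) ⟩
      Σ k (λ j → Σ k (λ m → g m * (binom j * S m j))) - Σ k (λ m → g m * S m k)
        ≈⟨ +-congʳ (Σ≤-swap k k _) ⟩
      Σ k (λ m → Σ k (λ j → g m * (binom j * S m j))) - Σ k (λ m → g m * S m k)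
        ≈⟨ +-congʳ (Σ≤-cong k (λ m _ → Σ≤-*ˡ k _ _)) ⟨
      Σ k (λ m → g m * Σ k (λ j → binom j * S m j)) - Σ k (λ m → g m * S m k)
        ≈⟨ Σ≤-- k _ _ ⟨
      Σ k (λ m → g m * Σ k (λ j → binom j * S m j) - g m * S m k)
        ≈⟨ Σ≤-cong k (λ m _ → trans (sym (x[y-z]≈xy-xz _ _ _)) (*-congˡ (sym (surjections-suc m k)))) ⟩
      Σ k (λ m → g m * S (suc m) k) ∎
      where
      S : ℕ → ℕ → Carrier
      S = surjections
      binom : ℕ → Carrier
      binom j = fromℕ K (k C j)

    Minv-mulZ : ∀ (g : PowerSeries K) k → Minv K (mulZ g) k ≈ Δ₁ K (Minv K g) k
    Minv-mulZ g k = begin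
      Minv K (mulZ g) k
        ≈⟨ Minv-surjections (mulZ g) k (ℕₚ.n≤1+n k) ⟩
      s * Σ (suc k) (λ m → mulZ g m * surjections m k)
        ≈⟨ *-congˡ (trans (Σ≤-head k _) (trans (+-congʳ (zeroˡ _)) (+-identityˡ _))) ⟩
      s * Σ k (λ m → g m * surjections (suc m) k)
        ≈⟨ *-congˡ (Σ≤-surjections-suc g k) ⟨
      s * (Σ k (λ j → binom j * T j) - T k)
        ≈⟨ x[y-z]≈xy-xz _ _ _ ⟩
      s * Σ k (λ j → binom j * T j) - s * T k
        ≈⟨ +-cong (trans (Σ≤-*ˡ k _ _) (Σ≤-cong k term)) (-‿cong (sym (Minv-surjections g k ℕₚ.≤-refl))) ⟩
      Σ k (λ j → sign (k ∸ j) * binom j * Minv K g j) - Minv K g k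
        ≈⟨ Δ₁-coefficients (Minv K g) k ⟨
      Δ₁ K (Minv K g) k ∎
      where
      s : Carrier
      s = sign (suc k)
      binom : ℕ → Carrier
      binom j = fromℕ K (k C j)
      T : ℕ → Carrier
      T j = Σ k (λ m → g m * surjections m j)
      term : ∀ j → j ≤ k → s * (binom j * T j) ≈ sign (k ∸ j) * binom j * Minv K g j
      term j j≤k = begin
        s * (binom j * T j)
          ≈⟨ *-congʳ (reflexive (≡.cong (λ i → sign (suc i)) (≡.sym (ℕₚ.m+[n∸m]≡n j≤k)))) ⟩
        sign (suc j ℕ.+ (k ∸ j)) * (binom j * T j)
          ≈⟨ *-congʳ (trans (signPow-+ (suc j) (k ∸ j)) (*-comm _ _)) ⟩
        (sign (k ∸ j) * sign (suc j)) * (binom j * T j)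
          ≈⟨ *-interchange _ _ _ _ ⟩
        (sign (k ∸ j) * binom j) * (sign (suc j) * T j)
          ≈⟨ *-congˡ (Minv-surjections g j j≤k) ⟨
        sign (k ∸ j) * binom j * Minv K g j ∎

    Minv-mulZ^ : ∀ n (g : PowerSeries K) k → Minv K (mulZ^ n g) k ≈ Δ₁^ K n (Minv K g) k
    Minv-mulZ^ zero    g k = refl
    Minv-mulZ^ (suc n) g k = trans (Minv-mulZ (mulZ^ n g) k) (Δ₁-cong (λ j → Minv-mulZ^ n g j) k)

proposition3p8 : {c ℓ : Level} (K : Field c ℓ) → CharZero K →
    (f g : PowerSeries K) → ∀ k →
    Field._≈_ K (Minv K (_⊛_ K f g) k) (Mhat K f (Minv K g) k)
proposition3p8 K char0 f g k = begin
  Minv K (_⊛_ K f g) k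
    ≈⟨ Minv-cong-≤ K k (λ m m≤k → ⊛-mulZ^ K f g m≤k) ⟩
  Minv K (λ m → Σ≤ K k (λ n → f n * mulZ^ K n g m)) k
    ≈⟨ Minv-Σ K f (λ n → mulZ^ K n g) k k ⟩
  Σ≤ K k (λ n → f n * Minv K (mulZ^ K n g) k)
    ≈⟨ Σ≤-cong K k (λ n _ → *-congˡ (Minv-mulZ^ K char0 n g k)) ⟩
  Mhat K f (Minv K g) k ∎
  where
  open Field K
  open SetoidReasoning setoid
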